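{- Let $G$ be an $r$-cop-win graph ($r\in\{0,1\}$) of finite corner rank $\alpha\ge 2$. Then Lower Way strategies and Catching strategies exist on $G$. Furthermore, if the cop follows a Lower Way strategy or a Catching strategy, the cop wins in at most $\alpha-r$ moves.
   Context: All graphs are finite, nonempty and reflexive (every vertex adjacent to itself). For distinct vertices $v,w$ of a graph $H$: $w$ corners $v$ in $H$ if every vertex of $H$ adjacent to $v$ is adjacent to $w$; $w$ strictly corners $v$ in $H$ if moreover some vertex of $H$ adjacent to $w$ is not adjacent to $v$; a strict corner of $H$ is a vertex strictly cornered in $H$ by another vertex. We also say $c$ corners $x$ in $H$ when $c=x$. Corner ranking: $G_1=G$, $k=1$. If $G_k$ is a clique, its vertices get rank $k$; stop. Else if $G_k$ has no strict corners, its vertices get rank $\infty$; stop. Else the set $X$ of strict corners of $G_k$ gets rank $k$, $G_{k+1}=G_k-X$, increase $k$, repeat. $\mathrm{cr}(v)$ denotes the rank of $v$ and $\mathrm{cr}(G)$ the maximum rank. For finite corner rank $\alpha\ge2$: $G$ is $1$-cop-win if some (equivalently every) vertex of rank $\alpha$ is adjacent to all vertices of $G_{\alpha-1}$, otherwise $0$-cop-win. Projections: for $k$ with $G_{k+1}$ defined, $f_k(\{u\})=\{u\}$ if $\mathrm{cr}(u)>k$, and otherwise the set of vertices of $G_{k+1}$ that strictly corner $u$ in $G_k$ ($u\in V(G_k)$); $f_k(S)=\bigcup_{u\in S}f_k(\{u\})$. $F_1$ is the identity on nonempty subsets of $V(G)$, $F_k=f_{k-1}\circ\cdots\circ f_1$,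 and $F_k(v)=F_k(\{v\})$. Game: cop places, robber places, then alternate moves with the cop first; a move is staying or moving to an adjacent vertex; cop wins when both share a vertex. With the cop at $c$ and robber at $x$: $x$ is $0$-cornered if $c=x$; for $k\ge1$, $x$ is $k$-cornered by $c$ if some $x'\in F_k(x)$ is cornered by $c$ in the subgraph induced by $V(G_k)\cup\{c\}$. The cop has $k$-caught the robber ($k\ge1$) if $c\in F_k(x)$. An initial cop placement is standard if that vertex is adjacent to every vertex of $G_{\alpha-r}$. A Lower Way strategy: standard initial placement, and for every $t\ge1$, after $t$ cop moves the cop $k$-corners the robber for some $k\le\alpha-r-t$. A Catching strategy: standard initial placement, and for every $t\ge1$, after $t$ cop moves the cop has $k$-caught the robber for some $k\le\alpha-r-t+1$. -}

module Defs where

open import Data.Nat using (ℕ; zero; suc; _+_; _∸_; _≤_; _<_)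
open import Data.Fin using (Fin; toℕ)
open import Data.Product using (Σ; _×_; _,_)
open import Data.Sum using (_⊎_)
open import Data.Unit using (⊤)
open import Relation.Nullary using (¬_)
open import Relation.Binary.PropositionalEquality using (_≡_; _≢_)
open import Relation.Binary.Definitions using (Decidable)

record Graph : Set₁ where
  field
    n        : ℕ
    nonempty : 0 < n
    _~_      : Fin n → Fin n → Set
    ~-dec    : Decidable _~_
    ~-refl   : ∀ v → v ~ v
    ~-sym    : ∀ {v w} → v ~ w → w ~ v

module _ (G : Graph) where
  open Graph G

  V : Set
  V = Fin n

  -- vertex subsets (an induced subgraph is given by its vertex set)
  VSet : Set₁
  VSet = V → Set

  Corners : VSet → V → V → Set
  Corners H w v = (w ≡ v) ⊎ ((w ≢ v) × (∀ u → H u → u ~ v → u ~ w))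

  StrictlyCorners : VSet → V → V → Set
  StrictlyCorners H w v =
    (w ≢ v) × (∀ u → H u → u ~ v → u ~ w) × Σ V (λ u → H u × (u ~ w) × ¬ (u ~ v))

  StrictCorner : VSet → V → Set
  StrictCorner H v = H v × Σ V (λ w → H w × StrictlyCorners H w v)

  IsClique : VSet → Set
  IsClique H = ∀ v w → H v → H w → v ~ w

  -- Gk k = vertex set of G_k (k ≥ 1); G_1 = G, G_{k+1} = G_k minus its strict corners.
  -- (index 0 is unused junk; after the process stops the sequence is stationary/unused)
  Gk : ℕ → VSet
  Gk zero          = λ _ → ⊤
  Gk (suc zero)    = λ _ → ⊤
  Gk (suc (suc k)) = λ v → Gk (suc k) v × ¬ StrictCorner (Gk (suc k)) v

  -- cr(v) = k  (finite rank k ≥ 1): v ∈ G_k, the process did not stop before k,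
  -- and either G_k is a clique or v is a strict corner of G_k.
  HasRank : V → ℕ → Set
  HasRank v k =
    (1 ≤ k) × Gk k v
    × (∀ j → 1 ≤ j → j < k → ¬ IsClique (Gk j) × Σ V (StrictCorner (Gk j)))
    × (IsClique (Gk k) ⊎ StrictCorner (Gk k) v)

  CornerRankIs : ℕ → Set
  CornerRankIs α = Σ V (λ v → HasRank v α) × (∀ v → Σ ℕ (λ j → j ≤ α × HasRank v j))

  CrGreater : V → ℕ → Set
  CrGreater u k = ¬ Σ ℕ (λ j → j ≤ k × HasRank u j)

  OneCopWin : ℕ → Set
  OneCopWin α = Σ V (λ v → HasRank v α × (∀ u → Gk (α ∸ 1) u → v ~ u))

  RCopWin : ℕ → ℕ → Set
  RCopWin α r = ((r ≡ 1) × OneCopWin α) ⊎ ((r ≡ 0) × ¬ OneCopWin α)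

  singleton : V → VSet
  singleton v w = w ≡ v

  f1 : ℕ → V → VSet
  f1 k u w = (CrGreater u k × (w ≡ u))
           ⊎ (¬ CrGreater u k × Gk (suc k) w × StrictlyCorners (Gk k) w u)

  fS : ℕ → VSet → VSet
  fS k S w = Σ V (λ u → S u × f1 k u w)

  -- F_k = f_{k-1} ∘ ... ∘ f_1, F_1 = id  (index 0 unused)
  F : ℕ → VSet → VSet
  F zero S          = S
  F (suc zero) S    = S
  F (suc (suc k)) S = fS (suc k) (F (suc k) S)

  KCornered : ℕ → V → V → Set
  KCornered zero c x    = c ≡ x
  KCornered (suc k) c x =
    Σ V (λ x' → F (suc k) (singleton x) x'
               × Corners (λ u → Gk (suc k) u ⊎ (u ≡ c)) c x')

  KCaught : ℕ → V → V → Set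
  KCaught k c x = F k (singleton x) c

  -- cop strategy: initial vertex, and the (t+1)-st move as a function of
  -- the robber positions x_0 … x_t
  record Strategy : Set where
    field
      start : V
      move  : (t : ℕ) → (Fin (suc t) → V) → V

  -- a play: c t = cop position after t cop moves, x t = robber position after
  -- the robber's placement (t = 0) / t-th move.
  Follows : Strategy → (ℕ → V) → (ℕ → V) → Set
  Follows σ c x = (c 0 ≡ Strategy.start σ)
                × (∀ t → c (suc t) ≡ Strategy.move σ t (λ i → x (toℕ i)))

  LegalMoves : (ℕ → V) → Set
  LegalMoves p = ∀ t → p t ~ p (suc t)

  -- the game ends at stage s: robber at/steps onto the cop (c s = x s),
  -- or the cop's s-th move (s ≥ 1) lands on the robber (c s = x (s-1))
  Captured : (ℕ → V) → (ℕ → V) → ℕ → Set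
  Captured c x s = (c s ≡ x s) ⊎ Σ ℕ (λ s' → (s ≡ suc s') × (c s ≡ x s'))

  NotOverBefore : (ℕ → V) → (ℕ → V) → ℕ → Set
  NotOverBefore c x t = ∀ s → s < t → ¬ Captured c x s

  CaughtWithin : (ℕ → V) → (ℕ → V) → ℕ → Set
  CaughtWithin c x m = Σ ℕ (λ s → s ≤ m × Captured c x s)

  Standard : ℕ → ℕ → V → Set
  Standard α r v = ∀ u → Gk (α ∸ r) u → v ~ u

  -- Lower Way strategy: k ≤ α - r - t  written as  k + t + r ≤ α
  LowerWay : ℕ → ℕ → Strategy → Set
  LowerWay α r σ =
    Standard α r (Strategy.start σ)
    × (∀ c x → Follows σ c x → LegalMoves x →
         LegalMoves c
         × (∀ t → 1 ≤ t → NotOverBefore c x t →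
              Σ ℕ (λ k → (k + t + r ≤ α) × KCornered k (c t) (x (t ∸ 1)))))

  -- Catching strategy: 1 ≤ k ≤ α - r - t + 1  written as  k + t + r ≤ α + 1
  Catching : ℕ → ℕ → Strategy → Set
  Catching α r σ =
    Standard α r (Strategy.start σ)
    × (∀ c x → Follows σ c x → LegalMoves x →
         LegalMoves c
         × (∀ t → 1 ≤ t → NotOverBefore c x t →
              Σ ℕ (λ k → (1 ≤ k) × (k + t + r ≤ α + 1) × KCaught k (c t) (x (t ∸ 1)))))

  WinsWithin : Strategy → ℕ → Set
  WinsWithin σ m = ∀ c x → Follows σ c x → LegalMoves x → CaughtWithin c x m

-- The cop starts on a vertex adjacent to all of G_{α-r}: for r = 1 this is
-- what 1-cop-win means, and for r = 0 the last level G_α is a clique (a strict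
-- corner of G_α would be strictly cornered by a non-corner of G_α, which could
-- not have rank ≤ α).  Afterwards the cop answers the robber at x by moving to
-- a point of F_{α-r-t}(x).  The projections f_k move a vertex only to a vertex
-- cornering it in G_k, so the images of adjacent robber positions at
-- consecutive levels are adjacent (the moves are legal), and a point of
-- F_{k+1}(x) k-corners x.  At t = α - r the level is 1, so the cop is on the
-- robber.  Conversely, the bounds in a Lower Way or Catching strategy leave at
-- t = α - r only 0-cornering resp. 1-catching, which is capture.

module Submission where

open import Defs
open import Data.Nat using (ℕ; zero; suc; pred; _+_; _∸_; _≤_; _<_; z≤n; s≤s; s≤s⁻¹; _≤?_)
open import Data.Nat.Properties
open import Data.Fin using (fromℕ)
open import Data.Fin.Properties using (all?; any?; toℕ-fromℕ) renaming (_≟_ to _≟ᶠ_)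
open import Data.Fin.Induction using (spo-noetherian)
open import Data.Product using (Σ; _×_; _,_; proj₁; proj₂)
open import Data.Sum using (_⊎_; inj₁; inj₂)
open import Data.Empty using (⊥-elim)
open import Function using (id; flip; _∘_)
open import Induction.WellFounded using (Acc; acc)
open import Relation.Binary.Structures using (IsStrictPartialOrder)
open import Relation.Binary.PropositionalEquality
open import Relation.Nullary using (¬_; Dec; yes; no)
open import Relation.Nullary.Decidable using (_×-dec_; _⊎-dec_; _→-dec_; ¬?; map′)
open import Relation.Unary using (Decidable)

m+n≡o⇒o∸n≡m : ∀ {m n o} → m + n ≡ o → o ∸ n ≡ m
m+n≡o⇒o∸n≡m {m} {n} refl = m+n∸n≡m m n

m+n+o≤p⇒m≡0 : ∀ {m n o p} → n + o ≡ p → m + n + o ≤ p → m ≡ 0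
m+n+o≤p⇒m≡0 {m} {n} {o} {p} n+o≡p le =
  n≤0⇒n≡0 (+-cancelʳ-≤ p m 0 (subst (_≤ p) (trans (+-assoc m n o) (cong (m +_) n+o≡p)) le))

<⇒∃1+a+r≡ : ∀ {r α} → r < α → Σ ℕ (λ a → suc a + r ≡ α)
<⇒∃1+a+r≡ {r} r<α with m≤n⇒∃[o]m+o≡n r<α
... | a , 1+r+a≡α = a , trans (+-comm (suc a) r) (trans (+-suc r a) 1+r+a≡α)

module _ (G : Graph) where
  open Graph G

  module Cornering (H : VSet G) where

    strictlyCorners-trans : ∀ {u v w} →
      StrictlyCorners G H w v → StrictlyCorners G H v u → StrictlyCorners G H w u
    strictlyCorners-trans (_ , v⊆w , _) (_ , u⊆v , z , z∈H , z~v , z≁u) =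
      (λ { refl → z≁u (v⊆w z z∈H z~v) }) ,
      (λ y y∈H y~u → v⊆w y y∈H (u⊆v y y∈H y~u)) ,
      z , z∈H , v⊆w z z∈H z~v , z≁u

    strictlyCorneredBy-isStrictPartialOrder :
      IsStrictPartialOrder _≡_ (flip (StrictlyCorners G H))
    strictlyCorneredBy-isStrictPartialOrder = record
      { isEquivalence = isEquivalence
      ; irrefl        = λ v≡w w⊐v → proj₁ w⊐v (sym v≡w)
      ; trans         = λ u⊏v v⊏w → strictlyCorners-trans v⊏w u⊏v
      ; <-resp-≈      = resp₂ (flip (StrictlyCorners G H))
      }

    strictlyCorners⇒corners : ∀ {v w} → StrictlyCorners G H w v → Corners G H w v
    strictlyCorners⇒corners (w≢v , v⊆w , _) = inj₂ (w≢v , v⊆w)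

    corners-dominates : ∀ {v w} → Corners G H w v → ∀ z → H z → z ~ v → z ~ w
    corners-dominates (inj₁ refl)      z _   z~v = z~v
    corners-dominates (inj₂ (_ , v⊆w)) z z∈H z~v = v⊆w z z∈H z~v

    corners-insert : ∀ {v c} → Corners G H c v → Corners G (λ u → H u ⊎ (u ≡ c)) c v
    corners-insert         (inj₁ c≡v)         = inj₁ c≡v
    corners-insert {c = c} (inj₂ (c≢v , v⊆c)) = inj₂ (c≢v , dominated)
      where
      dominated : ∀ u → H u ⊎ (u ≡ c) → u ~ _ → u ~ c
      dominated u (inj₁ u∈H) u~v = v⊆c u u∈H u~v
      dominated u (inj₂ refl) _  = ~-refl c

    module _ (H? : Decidable H) where

      strictlyCorners? : ∀ w v → Dec (StrictlyCorners G H w v)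
      strictlyCorners? w v =
        ¬? (w ≟ᶠ v)
        ×-dec all? (λ u → H? u →-dec (~-dec u v →-dec ~-dec u w))
        ×-dec any? (λ u → H? u ×-dec ~-dec u w ×-dec ¬? (~-dec u v))

      strictCorner? : Decidable (StrictCorner G H)
      strictCorner? v = H? v ×-dec any? (λ w → H? w ×-dec strictlyCorners? w v)

      strictCorner⇒cornered-by-nonCorner : ∀ {u} → StrictCorner G H u →
        Σ (V G) (λ w → H w × ¬ StrictCorner G H w × StrictlyCorners G H w u)
      strictCorner⇒cornered-by-nonCorner {u} =
        climb (spo-noetherian strictlyCorneredBy-isStrictPartialOrder u)
        where
        climb : ∀ {u} → Acc (StrictlyCorners G H) u → StrictCorner G H u →
          Σ (V G) (λ w → H w × ¬ StrictCorner G H w × StrictlyCorners G H w u)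
        climb (acc above) (_ , w , w∈H , w⊐u) with strictCorner? w
        ... | no w-nonCorner = w , w∈H , w-nonCorner , w⊐u
        ... | yes w-corner =
          let (w′ , w′∈H , w′-nonCorner , w′⊐w) = climb (above w⊐u) w-corner
          in  w′ , w′∈H , w′-nonCorner , strictlyCorners-trans w′⊐w w⊐u

  open Cornering

  Gk? : ∀ k → Decidable (Gk G k)
  Gk? zero          _ = yes _
  Gk? (suc zero)    _ = yes _
  Gk? (suc (suc k)) v = Gk? (suc k) v ×-dec ¬? (strictCorner? (Gk G (suc k)) (Gk? (suc k)) v)

  Gk-suc⊆ : ∀ k {v} → Gk G (suc k) v → Gk G k v
  Gk-suc⊆ zero    _          = _
  Gk-suc⊆ (suc k) (v∈Gk , _) = v∈Gk

  Gk-antitone : ∀ {i j v} → i ≤ j → Gk G j v → Gk G i v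
  Gk-antitone {j = zero} z≤n = id
  Gk-antitone {j = suc j} i≤1+j with m≤n⇒m<n∨m≡n i≤1+j
  ... | inj₁ i<1+j = Gk-antitone (s≤s⁻¹ i<1+j) ∘ Gk-suc⊆ j
  ... | inj₂ refl  = id

  Gk-suc⇒nonCorner : ∀ {j u} → 1 ≤ j → Gk G (suc j) u → ¬ StrictCorner G (Gk G j) u
  Gk-suc⇒nonCorner {suc j} _ = proj₂

  NotStoppedBefore : ℕ → Set
  NotStoppedBefore α =
    ∀ j → 1 ≤ j → j < α → ¬ IsClique G (Gk G j) × Σ (V G) (StrictCorner G (Gk G j))

  Fv : ℕ → V G → VSet G
  Fv k v = F G k (singleton G v)

  f1⇒corners : ∀ {k u w} → f1 G k u w → Corners G (Gk G k) w u
  f1⇒corners     (inj₁ (_ , refl))    = inj₁ refl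
  f1⇒corners {k} (inj₂ (_ , _ , w⊐u)) = strictlyCorners⇒corners (Gk G k) w⊐u

  Fv⇒kCornered : ∀ {k c x} → Fv (suc k) x c → KCornered G k c x
  Fv⇒kCornered {zero}  c≡x               = c≡x
  Fv⇒kCornered {suc k} (z , z∈Fx , c∈fz) =
    z , z∈Fx , corners-insert (Gk G (suc k)) (f1⇒corners c∈fz)

  module Ranking (α : ℕ) (notStopped : NotStoppedBefore α) where

    hasRank-below : ∀ {u j} → HasRank G u j → j < α → StrictCorner G (Gk G j) u
    hasRank-below (1≤j , _ , _ , inj₁ clique) j<α = ⊥-elim (proj₁ (notStopped _ 1≤j j<α) clique)
    hasRank-below (_   , _ , _ , inj₂ corner) _   = corner

    strictCorner⇒hasRank : ∀ {k u} → suc k ≤ α → Gk G (suc k) u →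
      StrictCorner G (Gk G (suc k)) u → HasRank G u (suc k)
    strictCorner⇒hasRank 1+k≤α u∈Gk corner =
      s≤s z≤n , u∈Gk , (λ j 1≤j j<1+k → notStopped j 1≤j (<-≤-trans j<1+k 1+k≤α)) , inj₂ corner

    nonCorner⇒crGreater : ∀ {k u} → suc k < α → Gk G (suc k) u →
      ¬ StrictCorner G (Gk G (suc k)) u → CrGreater G u (suc k)
    nonCorner⇒crGreater 1+k<α u∈Gk nonCorner (j , j≤1+k , rank)
      with hasRank-below rank (≤-<-trans j≤1+k 1+k<α) | m≤n⇒m<n∨m≡n j≤1+k
    ... | corner | inj₁ j<1+k = Gk-suc⇒nonCorner (proj₁ rank) (Gk-antitone j<1+k u∈Gk) corner
    ... | corner | inj₂ refl  = nonCorner corner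

    lastLevel-isClique : CornerRankIs G α → IsClique G (Gk G α)
    lastLevel-isClique ((_ , _ , _ , _ , inj₁ clique) , _) = clique
    lastLevel-isClique ((v , _ , v∈Gα , _ , inj₂ corner) , ranks)
      with strictCorner⇒cornered-by-nonCorner (Gk G α) (Gk? α) corner
    ... | w , w∈Gα , w-nonCorner , (_ , _ , z , z∈Gα , z~w , z≁v)
      with ranks w
    ... | j , j≤α , rank with m≤n⇒m<n∨m≡n j≤α
    ... | inj₁ j<α =
      ⊥-elim (Gk-suc⇒nonCorner (proj₁ rank) (Gk-antitone j<α w∈Gα) (hasRank-below rank j<α))
    ... | inj₂ refl with proj₂ (proj₂ (proj₂ rank))
    ...   | inj₁ clique = ⊥-elim (z≁v (clique z v z∈Gα v∈Gα))
    ...   | inj₂ w-corner = ⊥-elim (w-nonCorner w-corner)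

    f1⊆Gk : ∀ {k u w} → suc k ≤ α → Gk G (suc k) u → f1 G (suc k) u w → Gk G (suc (suc k)) w
    f1⊆Gk 1+k≤α u∈Gk (inj₁ (crGreater , refl)) =
      u∈Gk , λ corner → crGreater (_ , ≤-refl , strictCorner⇒hasRank 1+k≤α u∈Gk corner)
    f1⊆Gk _ _ (inj₂ (_ , w∈Gk+1 , _)) = w∈Gk+1

    project : ℕ → V G → V G
    project k u with strictCorner? (Gk G k) (Gk? k) u
    ... | yes corner = proj₁ (strictCorner⇒cornered-by-nonCorner (Gk G k) (Gk? k) corner)
    ... | no _       = u

    project-f1 : ∀ {k u} → suc k < α → Gk G (suc k) u → f1 G (suc k) u (project (suc k) u)
    project-f1 {k} {u} 1+k<α u∈Gk with strictCorner? (Gk G (suc k)) (Gk? (suc k)) u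
    ... | yes corner =
      let (_ , w∈Gk , w-nonCorner , w⊐u) =
            strictCorner⇒cornered-by-nonCorner (Gk G (suc k)) (Gk? (suc k)) corner
          notCrGreater crGreater =
            crGreater (_ , ≤-refl , strictCorner⇒hasRank (<⇒≤ 1+k<α) u∈Gk corner)
      in  inj₂ (notCrGreater , (w∈Gk , w-nonCorner) , w⊐u)
    ... | no nonCorner = inj₁ (nonCorner⇒crGreater 1+k<α u∈Gk nonCorner , refl)

    Fv⊆Gk : ∀ {k x a} → suc k ≤ α → Fv (suc k) x a → Gk G (suc k) a
    Fv⊆Gk {zero}  _     _                 = _
    Fv⊆Gk {suc k} 2+k≤α (u , u∈Fx , a∈fu) =
      f1⊆Gk (<⇒≤ 2+k≤α) (Fv⊆Gk (<⇒≤ 2+k≤α) u∈Fx) a∈fu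

    Fv-adjacent : ∀ {k x y a b} → suc k ≤ α → x ~ y → Fv (suc k) x a → Fv (suc k) y b → a ~ b
    Fv-step : ∀ {k x y c b} → suc (suc k) ≤ α → x ~ y →
      Fv (suc (suc k)) x c → Fv (suc k) y b → c ~ b

    Fv-adjacent {zero}  _     x~y refl refl = x~y
    Fv-adjacent {suc k} 2+k≤α x~y a∈Fx (v , v∈Fy , b∈fv) =
      corners-dominates (Gk G (suc k)) (f1⇒corners b∈fv) _
        (Gk-suc⊆ (suc k) (Fv⊆Gk 2+k≤α a∈Fx))
        (Fv-step 2+k≤α x~y a∈Fx v∈Fy)

    Fv-step {k} 2+k≤α x~y (z , z∈Fx , c∈fz) b∈Fy =
      ~-sym (corners-dominates (Gk G (suc k)) (f1⇒corners c∈fz) _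
               (Fv⊆Gk (<⇒≤ 2+k≤α) b∈Fy)
               (Fv-adjacent (<⇒≤ 2+k≤α) (~-sym x~y) b∈Fy z∈Fx))

    pursue : ℕ → V G → V G
    pursue zero    y = y
    pursue (suc k) y = project (suc k) (pursue k y)

    pursue-Fv : ∀ {k y} → suc k ≤ α → Fv (suc k) y (pursue k y)
    pursue-Fv {zero}  _     = refl
    pursue-Fv {suc k} 2+k≤α =
      _ , pursue-Fv (<⇒≤ 2+k≤α) , project-f1 2+k≤α (Fv⊆Gk (<⇒≤ 2+k≤α) (pursue-Fv (<⇒≤ 2+k≤α)))

    pursue-adjacent : ∀ {d x y} → suc d ≤ α → x ~ y → pursue d x ~ pursue (pred d) y
    pursue-adjacent {zero}  _     x~y = x~y
    pursue-adjacent {suc k} 2+k≤α x~y = Fv-step 2+k≤α x~y (pursue-Fv 2+k≤α) (pursue-Fv (<⇒≤ 2+k≤α))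

  captured? : ∀ c x → Decidable (Captured G c x)
  captured? c x s = (c s ≟ᶠ x s) ⊎-dec previous? s
    where
    previous? : ∀ s → Dec (Σ ℕ (λ s′ → (s ≡ suc s′) × (c s ≡ x s′)))
    previous? zero    = no λ ()
    previous? (suc s) = map′ (λ e → s , refl , e) (λ { (_ , refl , e) → e }) (c (suc s) ≟ᶠ x s)

  caughtWithin-if-caughtAt : ∀ {c x} a →
    (NotOverBefore G c x (suc a) → c (suc a) ≡ x a) → CaughtWithin G c x (suc a)
  caughtWithin-if-caughtAt {c} {x} a caughtAt with anyUpTo? (captured? c x) (suc a)
  ... | yes (s , s<1+a , captured) = s , <⇒≤ s<1+a , captured
  ... | no neverCaptured =
    suc a , ≤-refl ,
    inj₂ (a , refl , caughtAt (λ s s<1+a captured → neverCaptured (s , s<1+a , captured)))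

  lowerWay⇒winsWithin : ∀ {α r a σ} → suc a + r ≡ α → LowerWay G α r σ → WinsWithin G σ (α ∸ r)
  lowerWay⇒winsWithin {α} {r} {a} 1+a+r≡α (_ , lowerWay) c x follows robberLegal =
    subst (CaughtWithin G c x) (sym (m+n≡o⇒o∸n≡m 1+a+r≡α)) (caughtWithin-if-caughtAt a caughtAt)
    where
    caughtAt : NotOverBefore G c x (suc a) → c (suc a) ≡ x a
    caughtAt notOver with proj₂ (lowerWay c x follows robberLegal) (suc a) (s≤s z≤n) notOver
    ... | k , le , cornered with m+n+o≤p⇒m≡0 {k} 1+a+r≡α le
    ... | refl = cornered

  catching⇒winsWithin : ∀ {α r a σ} → suc a + r ≡ α → Catching G α r σ → WinsWithin G σ (α ∸ r)
  catching⇒winsWithin {α} {r} {a} 1+a+r≡α (_ , catching) c x follows robberLegal =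
    subst (CaughtWithin G c x) (sym (m+n≡o⇒o∸n≡m 1+a+r≡α)) (caughtWithin-if-caughtAt a caughtAt)
    where
    caughtAt : NotOverBefore G c x (suc a) → c (suc a) ≡ x a
    caughtAt notOver with proj₂ (catching c x follows robberLegal) (suc a) (s≤s z≤n) notOver
    ... | suc k , _ , le , caught
      with m+n+o≤p⇒m≡0 {k} 1+a+r≡α (s≤s⁻¹ (subst (suc k + suc a + r ≤_) (+-comm α 1) le))
    ... | refl = caught

  standardVertex : ∀ {α r} → CornerRankIs G α → RCopWin G α r → Σ (V G) (Standard G α r)
  standardVertex _ (inj₁ (refl , v , _ , v-dominates)) = v , v-dominates
  standardVertex rank@((v , _ , v∈Gα , notStopped , _) , _) (inj₂ (refl , _)) =
    v , λ u u∈Gα → Ranking.lastLevel-isClique _ notStopped rank v u v∈Gα u∈Gα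

  module Pursuit (α : ℕ) (notStopped : NotStoppedBefore α) (r a : ℕ) (1+a+r≡α : suc a + r ≡ α)
                 (s₀ : V G) (standard : Standard G α r s₀) where
    open Ranking α notStopped

    chase : Strategy G
    chase = record { start = s₀ ; move = λ t xs → pursue (a ∸ t) (xs (fromℕ t)) }

    α∸r≡1+a : α ∸ r ≡ suc a
    α∸r≡1+a = m+n≡o⇒o∸n≡m 1+a+r≡α

    1+a≤α : suc a ≤ α
    1+a≤α = subst (suc a ≤_) 1+a+r≡α (m≤m+n (suc a) r)

    ∸+suc≡suc : ∀ {t} → t ≤ a → a ∸ t + suc t ≡ suc a
    ∸+suc≡suc {t} t≤a = trans (+-suc (a ∸ t) t) (cong suc (m∸n+n≡m t≤a))

    module _ {c x : ℕ → V G} (follows : Follows G chase c x) (robberLegal : LegalMoves G x) where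

      cop-position : ∀ t → c (suc t) ≡ pursue (a ∸ t) (x t)
      cop-position t = trans (proj₂ follows t) (cong (λ i → pursue (a ∸ t) (x i)) (toℕ-fromℕ t))

      cop-Fv : ∀ t → Fv (suc (a ∸ t)) (x t) (c (suc t))
      cop-Fv t = subst (Fv (suc (a ∸ t)) (x t)) (sym (cop-position t))
                   (pursue-Fv {a ∸ t} (≤-trans (s≤s (m∸n≤m a t)) 1+a≤α))

      chase-legal : LegalMoves G c
      chase-legal zero rewrite proj₁ follows =
        standard (c 1) (subst (λ i → Gk G i (c 1)) (sym α∸r≡1+a) (Fv⊆Gk {a} {x 0} 1+a≤α (cop-Fv 0)))
      chase-legal (suc t) rewrite cop-position t | cop-position (suc t)
                                | sym (pred[m∸n]≡m∸[1+n] a t) =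
        pursue-adjacent (≤-trans (s≤s (m∸n≤m a t)) 1+a≤α) (robberLegal t)

      caught-after-a : ∀ t → a ≤ t → Captured G c x (suc t)
      caught-after-a t a≤t =
        inj₂ (t , refl , trans (cop-position t) (cong (λ d → pursue d (x t)) (m≤n⇒m∸n≡0 a≤t)))

      over-after-a : ∀ t → a < t → ¬ NotOverBefore G c x (suc t)
      over-after-a (suc t) (s≤s a≤t) notOver = notOver (suc t) ≤-refl (caught-after-a t a≤t)

      chase-progress : ∀ t → NotOverBefore G c x (suc t) →
        Σ ℕ (λ k → (k + suc t + r ≡ α) × Fv (suc k) (x t) (c (suc t)))
      chase-progress t notOver with t ≤? a
      ... | yes t≤a = a ∸ t , trans (cong (_+ r) (∸+suc≡suc t≤a)) 1+a+r≡α , cop-Fv t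
      ... | no t≰a  = ⊥-elim (over-after-a t (≰⇒> t≰a) notOver)

    chase-lowerWay : LowerWay G α r chase
    chase-lowerWay = standard , λ c x follows robberLegal →
      chase-legal follows robberLegal , λ where
        (suc t) _ notOver →
          let (k , k+t+r≡α , c∈Fx) = chase-progress follows robberLegal t notOver
          in  k , ≤-reflexive k+t+r≡α , Fv⇒kCornered c∈Fx

    chase-catching : Catching G α r chase
    chase-catching = standard , λ c x follows robberLegal →
      chase-legal follows robberLegal , λ where
        (suc t) _ notOver →
          let (k , k+t+r≡α , c∈Fx) = chase-progress follows robberLegal t notOver
          in  suc k , s≤s z≤n , ≤-reflexive (trans (cong suc k+t+r≡α) (+-comm 1 α)) , c∈Fx

  rCopWin⇒r≤1 : ∀ {α r} → RCopWin G α r → r ≤ 1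
  rCopWin⇒r≤1 (inj₁ (refl , _)) = ≤-refl
  rCopWin⇒r≤1 (inj₂ (refl , _)) = z≤n

theorem4p12 : (G : Graph) (α r : ℕ) → 2 ≤ α → CornerRankIs G α → RCopWin G α r →
    Σ (Strategy G) (LowerWay G α r)
    × Σ (Strategy G) (Catching G α r)
    × (∀ σ → LowerWay G α r σ → WinsWithin G σ (α ∸ r))
    × (∀ σ → Catching G α r σ → WinsWithin G σ (α ∸ r))
theorem4p12 G α r 2≤α rank@((_ , _ , _ , notStopped , _) , _) copWin
  with <⇒∃1+a+r≡ (<-≤-trans (s≤s (rCopWin⇒r≤1 G copWin)) 2≤α)
     | standardVertex G rank copWin
... | a , 1+a+r≡α | s₀ , standard =
  (chase , chase-lowerWay) , (chase , chase-catching) ,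
  (λ σ → lowerWay⇒winsWithin G {σ = σ} 1+a+r≡α) , (λ σ → catching⇒winsWithin G {σ = σ} 1+a+r≡α)
  where open Pursuit G α notStopped r a 1+a+r≡α s₀ standard
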